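{- Let $\mathsf{R}$ be an $a\times b$-orchard in a graph. There is a collection $\mathcal{C}$ of at most $a^2$ subgraphs of $\mathsf{R}$ such that every element of $\mathcal{C}$ is a myriapod whose spine is a horizontal path of $\mathsf{R}$ and each of whose legs is contained in some vertical tree of $\mathsf{R}$, and every section of $\mathsf{R}$ is contained in some element of $\mathcal{C}$.
   Context: An $a\times b$-orchard $\mathsf{R}$ in $G$ ($a,b$ positive integers) consists of pairwise vertex-disjoint paths $P_1,\dots,P_a$ (horizontal paths) and pairwise vertex-disjoint trees $T_1,\dots,T_b$ (vertical trees) such that each $P_i\cap T_j$ is non-empty and connected and every leaf of each $T_j$ lies on some horizontal path; $\mathsf{R}$ also denotes the subgraph that is the union of these paths and trees. Let $\mathsf{P}=\bigcup_i P_i$, $\mathsf{T}=\bigcup_j T_j$. A horizontal section is a path $P_i\cap T_j$ or a component of $\mathsf{P}-V(\mathsf{T})$. Let $W$ be the set of vertices $w\in V(T_j)\setminus V(\mathsf{P})$ with $\deg_{T_j}(w)\ge3$ for some $j$. A vertical section is a single vertex of $W$ or a component of $\mathsf{T}-(V(\mathsf{P})\cup W)$. A section is a horizontal or vertical section. A myriapod is a tree of maximum degree at most 3 all of whose degree-3 vertices lie on a single path $P$, called its spine; its legs are the components of the tree minus $V(P)$. -}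

module Defs where

open import Data.Nat using (ℕ; zero; suc; _≤_; _*_)
open import Data.Fin using (Fin; zero; suc; _≟_)
open import Data.Bool using (Bool; true; false; _∧_; _∨_)
open import Data.List using (List; []; _∷_; length; _++_; last)
open import Data.List.Membership.Propositional using (_∈_)
open import Data.List.Relation.Unary.All using (All)
open import Data.List.Relation.Unary.Any using (Any)
open import Data.List.Relation.Unary.Unique.Propositional using (Unique)
open import Data.List.Relation.Unary.Linked using (Linked)
open import Data.Maybe using (just)
open import Data.Product using (Σ; ∃; ∃-syntax; _×_; _,_)
open import Data.Sum using (_⊎_)
open import Data.Empty using (⊥)
open import Relation.Nullary using (¬_; does)
open import Relation.Binary.PropositionalEquality using (_≡_; _≢_)
open import Function.Bundles using (_⇔_)

record Graph : Set where
  field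
    n      : ℕ
    adj    : Fin n → Fin n → Bool
    sym    : ∀ x y → adj x y ≡ adj y x
    irrefl : ∀ x → adj x x ≡ false
open Graph public

-- A (candidate) subgraph: decidable vertex set and edge set (edges as a
-- symmetric Bool relation).
record Sub (n : ℕ) : Set where
  constructor sub
  field
    vs : Fin n → Bool
    es : Fin n → Fin n → Bool
open Sub public

module _ {n : ℕ} where

  _⊆ₛ_ : Sub n → Sub n → Set
  H ⊆ₛ K = (∀ x → vs H x ≡ true → vs K x ≡ true)
         × (∀ x y → es H x y ≡ true → es K x y ≡ true)

  _≐_ : Sub n → Sub n → Set
  H ≐ K = (∀ x → vs H x ≡ vs K x) × (∀ x y → es H x y ≡ es K x y)

  WF : Sub n → Set
  WF H = (∀ x y → es H x y ≡ true → vs H x ≡ true)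
       × (∀ x y → es H x y ≡ true → es H y x ≡ true)

  _∩ₛ_ : Sub n → Sub n → Sub n
  H ∩ₛ K = sub (λ x → vs H x ∧ vs K x) (λ x y → es H x y ∧ es K x y)

  _∪ₛ_ : Sub n → Sub n → Sub n
  H ∪ₛ K = sub (λ x → vs H x ∨ vs K x) (λ x y → es H x y ∨ es K x y)

  emptyₛ : Sub n
  emptyₛ = sub (λ _ → false) (λ _ _ → false)

  single : Fin n → Sub n
  single w = sub (λ x → does (x ≟ w)) (λ _ _ → false)

  Nonempty : Sub n → Set
  Nonempty H = ∃[ x ] vs H x ≡ true

  data Walk (H : Sub n) : Fin n → Fin n → Set where
    here : ∀ {x} → vs H x ≡ true → Walk H x x
    step : ∀ {x y z} → es H x y ≡ true → Walk H y z → Walk H x z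

  Connected : Sub n → Set
  Connected H = ∀ x y → vs H x ≡ true → vs H y ≡ true → Walk H x y

  DegAtLeast : Sub n → Fin n → ℕ → Set
  DegAtLeast H v k = ∃[ ns ] (length ns ≡ k × Unique ns × All (λ u → es H v u ≡ true) ns)

  Leaf : Sub n → Fin n → Set
  Leaf H v = vs H v ≡ true × DegAtLeast H v 1 × ¬ DegAtLeast H v 2

  HasCycle : Sub n → Set
  HasCycle H = ∃[ x ] ∃[ xs ] (3 ≤ length (x ∷ xs) × Unique (x ∷ xs)
             × Linked (λ u v → es H u v ≡ true) (x ∷ xs)
             × ∃[ y ] (last (x ∷ xs) ≡ just y × es H y x ≡ true))

  IsTree : Sub n → Set
  IsTree H = WF H × Nonempty H × Connected H × ¬ HasCycle H

  Consec : List (Fin n) → Fin n → Fin n → Set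
  Consec xs x y = ∃[ as ] ∃[ bs ] (xs ≡ as ++ (x ∷ y ∷ bs))

IsPath : (G : Graph) → Sub (n G) → Set
IsPath G H = ∃[ x ] ∃[ xs ] (Unique (x ∷ xs) × Linked (λ u v → adj G u v ≡ true) (x ∷ xs)
           × (∀ v → (vs H v ≡ true) ⇔ (v ∈ (x ∷ xs)))
           × (∀ u v → (es H u v ≡ true) ⇔ (Consec (x ∷ xs) u v ⊎ Consec (x ∷ xs) v u)))

fullₛ : (G : Graph) → Sub (n G)
fullₛ G = sub (λ _ → true) (adj G)

IsSubgraph : (G : Graph) → Sub (n G) → Set
IsSubgraph G H = WF H × H ⊆ₛ fullₛ G

⋃ : ∀ {n k} → (Fin k → Sub n) → Sub n
⋃ {k = zero}  F = emptyₛ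
⋃ {k = suc k} F = F zero ∪ₛ ⋃ (λ i → F (suc i))

-- C is a component of H - X (X a set of vertices): a maximal connected
-- subgraph of the subgraph of H induced on V(H) \ X.
IsComponentAvoiding : ∀ {n} → Sub n → (Fin n → Set) → Sub n → Set
IsComponentAvoiding H X C =
    C ⊆ₛ H
  × (∀ x → vs C x ≡ true → ¬ X x)
  × (∀ x y → es C x y ≡ es H x y ∧ (vs C x ∧ vs C y))
  × Nonempty C × Connected C
  × (∀ x y → vs C x ≡ true → es H x y ≡ true → ¬ X y → vs C y ≡ true)

record Orchard (G : Graph) (a b : ℕ) : Set where
  field
    a-pos : 1 ≤ a
    b-pos : 1 ≤ b
    P : Fin a → Sub (n G)
    T : Fin b → Sub (n G)
    P-path : ∀ i → IsPath G (P i)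
    T-sub  : ∀ j → IsSubgraph G (T j)
    T-tree : ∀ j → IsTree (T j)
    P-disj : ∀ i i' → i ≢ i' → ∀ x → vs (P i) x ≡ true → vs (P i') x ≡ true → ⊥
    T-disj : ∀ j j' → j ≢ j' → ∀ x → vs (T j) x ≡ true → vs (T j') x ≡ true → ⊥
    PT-nonempty  : ∀ i j → Nonempty (P i ∩ₛ T j)
    PT-connected : ∀ i j → Connected (P i ∩ₛ T j)
    leaves : ∀ j x → Leaf (T j) x → ∃[ i ] vs (P i) x ≡ true

module _ {G : Graph} {a b : ℕ} (R : Orchard G a b) where
  open Orchard R

  Pall : Sub (n G)
  Pall = ⋃ P

  Tall : Sub (n G)
  Tall = ⋃ T

  Rsub : Sub (n G)
  Rsub = Pall ∪ₛ Tall

  InW : Fin (n G) → Set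
  InW w = ∃[ j ] (vs (T j) w ≡ true × vs Pall w ≡ false × DegAtLeast (T j) w 3)

  HorizontalSection : Sub (n G) → Set
  HorizontalSection S =
      (∃[ i ] ∃[ j ] S ≐ (P i ∩ₛ T j))
    ⊎ IsComponentAvoiding Pall (λ x → vs Tall x ≡ true) S

  VerticalSection : Sub (n G) → Set
  VerticalSection S =
      (∃[ w ] (InW w × S ≐ single w))
    ⊎ IsComponentAvoiding Tall (λ x → vs Pall x ≡ true ⊎ InW x) S

  Section : Sub (n G) → Set
  Section S = HorizontalSection S ⊎ VerticalSection S

  GoodMyriapod : Sub (n G) → Set
  GoodMyriapod M =
      M ⊆ₛ Rsub
    × ∃[ i ] ( IsTree M
             × (∀ v → ¬ DegAtLeast M v 4)
             × P i ⊆ₛ M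
             × (∀ v → vs M v ≡ true → DegAtLeast M v 3 → vs (P i) v ≡ true)
             × (∀ L → IsComponentAvoiding M (λ x → vs (P i) x ≡ true) L → ∃[ j ] L ⊆ₛ T j))

-- For horizontal paths P i, P i′ and a vertical tree T j, the leg of T j from P i towards P i′ is the
-- path of T j from P i to P i′, cut at its last vertex on P i. The spine P i together with the legs of
-- all vertical trees towards P i′ is a myriapod: it is a tree because every vertex but the start of the
-- spine has exactly one neighbour one step closer to that start, and vertices of degree three lie on
-- the spine because a leg meets the spine only at its root. These a² myriapods cover all sections.
-- Horizontal sections lie on a spine. A vertex s of T j on no horizontal path is not a leaf, and from
-- two of its neighbours maximal paths avoiding s run to leaves, i.e. to horizontal paths P i₁ and P i₂;
-- if s were not on the leg from P i₁ towards P i₂, the two sides would be joined around s, closing a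
-- cycle in T j. A vertical section containing s stays on that leg, since a third neighbour in T j would
-- make a vertex of the leg a branch vertex of W.

module Submission where

open import Defs
open import Data.Nat using (ℕ; _≤_; _*_)
open import Data.List using (List; length)
open import Data.List.Relation.Unary.All using (All)
open import Data.List.Relation.Unary.Any using (Any)
open import Data.Product using (∃-syntax; _×_)
open import Data.Nat using (zero; suc; _+_; z≤n; s≤s)
open import Data.Nat.Properties using (≤-trans; <-irrefl; ≤-reflexive; m≢1+n+m; +-suc; +-identityʳ; n≤1+n)
open import Data.Fin using (Fin; zero; suc; _≟_; fromℕ<)
open import Data.Fin.Properties using (injective⇒≤; any?)
open import Data.Bool using (Bool; true; false; not; _∧_; _∨_)
open import Data.List using ([]; _∷_; last; lookup; map; allFin; cartesianProductWith)
open import Data.List.Properties using (length-++; length-map; length-tabulate)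
open import Data.List.Extrema.Nat using (argmax; argmax-all; f[⊥]≤f[argmax]; f[xs]≤f[argmax])
open import Data.List.Membership.Propositional using (_∈_; _∉_)
open import Data.List.Membership.Propositional.Properties using (∈-lookup; ∈-allFin)
open import Data.List.Relation.Binary.Subset.Propositional using (_⊆_)
open import Data.List.Relation.Unary.All as All using ([]; _∷_)
open import Data.List.Relation.Unary.All.Properties as Allₚ using (¬Any⇒All¬)
open import Data.List.Relation.Unary.Any as Any using (here; there)
import Data.List.Relation.Unary.Any.Properties as Anyₚ
open import Data.List.Relation.Unary.AllPairs as AllPairs using ([]; _∷_)
open import Data.List.Relation.Unary.Unique.Propositional using (Unique)
open import Data.List.Relation.Unary.Unique.Propositional.Properties using (Unique[x∷xs]⇒x∉xs)
open import Data.List.Relation.Unary.Linked using (Linked; []; [-]; _∷_)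
open import Data.Maybe using (just)
open import Data.Product using (Σ; _,_; proj₁; proj₂)
open import Data.Sum using (_⊎_; inj₁; inj₂; [_,_]′; swap)
import Data.Sum as Sum
open import Data.Empty using (⊥; ⊥-elim)
open import Function using (_∘_; id)
open import Function.Bundles using (Equivalence)
open import Function.Definitions using (Injective)
open import Relation.Nullary using (¬_; Dec; yes; no; does)
open import Relation.Nullary.Decidable using (dec-true)
open import Relation.Binary.PropositionalEquality using (_≡_; _≢_; refl; trans; cong; cong₂; subst)
import Relation.Binary.PropositionalEquality as ≡

∨-introˡ : ∀ {x} y → x ≡ true → x ∨ y ≡ true
∨-introˡ _ refl = refl

∨-introʳ : ∀ x {y} → y ≡ true → x ∨ y ≡ true
∨-introʳ true  _ = refl
∨-introʳ false p = p

∨-elim : ∀ x {y} → x ∨ y ≡ true → x ≡ true ⊎ y ≡ true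
∨-elim true  _ = inj₁ refl
∨-elim false p = inj₂ p

∧-elimˡ : ∀ x {y} → x ∧ y ≡ true → x ≡ true
∧-elimˡ true  _ = refl
∧-elimˡ false ()

∧-elimʳ : ∀ x {y} → x ∧ y ≡ true → y ≡ true
∧-elimʳ true  p = p
∧-elimʳ false ()

∧-intro : ∀ {x y} → x ≡ true → y ≡ true → x ∧ y ≡ true
∧-intro refl refl = refl

true≢false : ∀ {x} → x ≡ true → x ≡ false → ⊥
true≢false refl ()

¬true⇒false : ∀ {x} → ¬ x ≡ true → x ≡ false
¬true⇒false {true}  ¬t = ⊥-elim (¬t refl)
¬true⇒false {false} _  = refl

dec-true⁻ : ∀ {P : Set} (d : Dec P) → does d ≡ true → P
dec-true⁻ (yes p) _ = p

lookup-injective : ∀ {A : Set} {xs : List A} → Unique xs → Injective _≡_ _≡_ (lookup xs)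
lookup-injective (_  ∷ _)  {zero}  {zero}  _  = refl
lookup-injective (x∉ ∷ _)  {zero}  {suc j} eq = ⊥-elim (All.lookup x∉ (∈-lookup j) eq)
lookup-injective (x∉ ∷ _)  {suc i} {zero}  eq = ⊥-elim (All.lookup x∉ (∈-lookup i) (≡.sym eq))
lookup-injective (_  ∷ un) {suc i} {suc j} eq = cong suc (lookup-injective un eq)

unique⇒length≤ : ∀ {n} {xs : List (Fin n)} → Unique xs → length xs ≤ n
unique⇒length≤ u = injective⇒≤ (lookup-injective u)

length-allFin : ∀ k → length (allFin k) ≡ k
length-allFin k = length-tabulate {n = k} id

length-cartesianProductWith : ∀ {A B C : Set} (f : A → B → C) xs ys →
  length (cartesianProductWith f xs ys) ≡ length xs * length ys
length-cartesianProductWith f []       ys = refl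
length-cartesianProductWith f (x ∷ xs) ys =
  trans (length-++ (map (f x) ys))
        (cong₂ _+_ (length-map (f x) ys) (length-cartesianProductWith f xs ys))

module _ {A : Set} where

  data Next : List A → A → A → Set where
    next-here  : ∀ {x y xs} → Next (x ∷ y ∷ xs) x y
    next-there : ∀ {x xs u v} → Next xs u v → Next (x ∷ xs) u v

  Next-∈ˡ : ∀ {xs u v} → Next xs u v → u ∈ xs
  Next-∈ˡ next-here      = here refl
  Next-∈ˡ (next-there p) = there (Next-∈ˡ p)

  Next-∈ʳ : ∀ {xs u v} → Next xs u v → v ∈ xs
  Next-∈ʳ next-here      = there (here refl)
  Next-∈ʳ (next-there p) = there (Next-∈ʳ p)

  Next-∈-tail : ∀ {x xs u v} → Next (x ∷ xs) u v → v ∈ xs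
  Next-∈-tail next-here      = here refl
  Next-∈-tail (next-there p) = Next-∈ʳ p

  ∈-tail : ∀ {x m : A} {xs} → m ∈ x ∷ xs → m ≢ x → m ∈ xs
  ∈-tail (here m≡x) m≢x = ⊥-elim (m≢x m≡x)
  ∈-tail (there m∈) _   = m∈

  ∈-tail⇒Next : ∀ {x xs u} → u ∈ xs → ∃[ w ] Next (x ∷ xs) w u
  ∈-tail⇒Next (here refl) = _ , next-here
  ∈-tail⇒Next (there m)   = let w , p = ∈-tail⇒Next m in w , next-there p

  Linked⇒Next : ∀ {R : A → A → Set} {xs u v} → Linked R xs → Next xs u v → R u v
  Linked⇒Next (r ∷ _) next-here      = r
  Linked⇒Next (_ ∷ l) (next-there p) = Linked⇒Next l p
  Linked⇒Next [-]     (next-there ())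

  Next-functionalʳ : ∀ {xs u v w} → Unique xs → Next xs u v → Next xs u w → v ≡ w
  Next-functionalʳ _        next-here      next-here      = refl
  Next-functionalʳ un       next-here      (next-there q) = ⊥-elim (Unique[x∷xs]⇒x∉xs un (Next-∈ˡ q))
  Next-functionalʳ un       (next-there p) next-here      = ⊥-elim (Unique[x∷xs]⇒x∉xs un (Next-∈ˡ p))
  Next-functionalʳ (_ ∷ un) (next-there p) (next-there q) = Next-functionalʳ un p q

  Next-functionalˡ : ∀ {xs u v w} → Unique xs → Next xs u w → Next xs v w → u ≡ v
  Next-functionalˡ _        next-here      next-here      = refl
  Next-functionalˡ (_ ∷ un) next-here      (next-there q) = ⊥-elim (Unique[x∷xs]⇒x∉xs un (Next-∈-tail q))
  Next-functionalˡ (_ ∷ un) (next-there p) next-here      = ⊥-elim (Unique[x∷xs]⇒x∉xs un (Next-∈-tail p))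
  Next-functionalˡ (_ ∷ un) (next-there p) (next-there q) = Next-functionalˡ un p q

module _ {n : ℕ} where

  _∈?_ : (x : Fin n) (xs : List (Fin n)) → Dec (x ∈ xs)
  x ∈? xs = Any.any? (x ≟_) xs

  _≢ᵇ_ : Fin n → Fin n → Bool
  x ≢ᵇ y = not (does (x ≟ y))

  ≢ᵇ⇒≢ : ∀ {x y} → x ≢ᵇ y ≡ true → x ≢ y
  ≢ᵇ⇒≢ {x} {y} p with x ≟ y
  ≢ᵇ⇒≢ () | yes _
  ... | no x≢y = x≢y

  ≢⇒≢ᵇ : ∀ {x y} → x ≢ y → x ≢ᵇ y ≡ true
  ≢⇒≢ᵇ {x} {y} x≢y with x ≟ y
  ... | yes x≡y = ⊥-elim (x≢y x≡y)
  ... | no  _   = refl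

  next? : (xs : List (Fin n)) (u v : Fin n) → Dec (Next xs u v)
  next? []           u v = no λ ()
  next? (x ∷ [])     u v = no λ { (next-there ()) }
  next? (x ∷ y ∷ xs) u v with next? (y ∷ xs) u v | x ≟ u | y ≟ v
  ... | yes p | _        | _        = yes (next-there p)
  ... | no ¬p | yes refl | yes refl = yes next-here
  ... | no ¬p | yes refl | no y≢v   = no λ { next-here → y≢v refl ; (next-there p) → ¬p p }
  ... | no ¬p | no x≢u   | _        = no λ { next-here → x≢u refl ; (next-there p) → ¬p p }

  Consec⇒Next : ∀ {xs : List (Fin n)} {u v} → Consec xs u v → Next xs u v
  Consec⇒Next ([]     , _ , refl) = next-here
  Consec⇒Next (_ ∷ as , bs , refl) = next-there (Consec⇒Next (as , bs , refl))

  Next⇒Consec : ∀ {xs : List (Fin n)} {u v} → Next xs u v → Consec xs u v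
  Next⇒Consec {_ ∷ _ ∷ xs} next-here = [] , xs , refl
  Next⇒Consec {x ∷ _} (next-there p) with Next⇒Consec p
  ... | as , bs , refl = x ∷ as , bs , refl

  index : Fin n → List (Fin n) → ℕ
  index v []       = 0
  index v (x ∷ xs) with v ≟ x
  ... | yes _ = 0
  ... | no  _ = suc (index v xs)

  index-head : ∀ x xs → index x (x ∷ xs) ≡ 0
  index-head x xs with x ≟ x
  ... | yes _   = refl
  ... | no  x≢x = ⊥-elim (x≢x refl)

  index-tail : ∀ {v x} xs → v ≢ x → index v (x ∷ xs) ≡ suc (index v xs)
  index-tail {v} {x} xs v≢x with v ≟ x
  ... | yes v≡x = ⊥-elim (v≢x v≡x)
  ... | no  _   = refl

  Next-index : ∀ {xs u v} → Unique xs → Next xs u v → index v xs ≡ suc (index u xs)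
  Next-index {x ∷ y ∷ xs} (x∉ ∷ _) next-here = begin
      index y (x ∷ y ∷ xs)  ≡⟨ index-tail (y ∷ xs) (λ y≡x → All.lookup x∉ (here refl) (≡.sym y≡x)) ⟩
      suc (index y (y ∷ xs)) ≡⟨ cong suc (trans (index-head y xs) (≡.sym (index-head x (y ∷ xs)))) ⟩
      suc (index x (x ∷ y ∷ xs)) ∎
    where open ≡.≡-Reasoning
  Next-index {x ∷ xs} (x∉ ∷ un) (next-there p) = begin
      index _ (x ∷ xs)       ≡⟨ index-tail xs (λ v≡x → All.lookup x∉ (Next-∈ʳ p) (≡.sym v≡x)) ⟩
      suc (index _ xs)       ≡⟨ cong suc (Next-index un p) ⟩
      suc (suc (index _ xs)) ≡⟨ cong suc (≡.sym (index-tail xs (λ u≡x → All.lookup x∉ (Next-∈ˡ p) (≡.sym u≡x)))) ⟩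
      suc (index _ (x ∷ xs)) ∎
    where open ≡.≡-Reasoning

  Next-pred≢succ : ∀ {xs u v w} → Unique xs → Next xs u v → Next xs v w → u ≢ w
  Next-pred≢succ {xs} {u} un uv vw refl =
    m≢1+n+m (index u xs) (trans (Next-index un vw) (cong suc (Next-index un uv)))

data Chain {A : Set} (E : A → A → Set) : A → A → List A → Set where
  ε   : ∀ {x} → Chain E x x []
  _◅_ : ∀ {x y z ys} → E x y → Chain E y z ys → Chain E x z (y ∷ ys)

module _ {A : Set} {E : A → A → Set} where

  Chain⇒Linked : ∀ {x z ys} → Chain E x z ys → Linked E (x ∷ ys)
  Chain⇒Linked ε       = [-]
  Chain⇒Linked (e ◅ c) = e ∷ Chain⇒Linked c

  Linked⇒Chain : ∀ {x z ys} → Linked E (x ∷ ys) → last (x ∷ ys) ≡ just z → Chain E x z ys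
  Linked⇒Chain {ys = []}    [-]     refl = ε
  Linked⇒Chain {ys = _ ∷ _} (e ∷ l) eq   = e ◅ Linked⇒Chain l eq

  Chain-last : ∀ {x z ys} → Chain E x z ys → last (x ∷ ys) ≡ just z
  Chain-last ε             = refl
  Chain-last (_ ◅ ε)       = refl
  Chain-last (_ ◅ (e ◅ c)) = Chain-last (e ◅ c)

  Chain-map : ∀ {F : A → A → Set} → (∀ {u v} → E u v → F u v) → ∀ {x z ys} → Chain E x z ys → Chain F x z ys
  Chain-map f ε       = ε
  Chain-map f (e ◅ c) = f e ◅ Chain-map f c

  Chain-end : ∀ {x z ys} → Chain E x z ys → z ∈ x ∷ ys
  Chain-end ε       = here refl
  Chain-end (_ ◅ c) = there (Chain-end c)

  Chain-loop : ∀ {x ys} → Chain E x x ys → Unique (x ∷ ys) → ys ≡ []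
  Chain-loop ε       _  = refl
  Chain-loop (_ ◅ c) un = ⊥-elim (Unique[x∷xs]⇒x∉xs un (Chain-end c))

  no-Next-first-last : ∀ {x y xs} → 3 ≤ length (x ∷ xs) → Unique (x ∷ xs) →
    Chain E x y xs → ¬ Next (x ∷ xs) x y
  no-Next-first-last (s≤s ()) _ ε _
  no-Next-first-last len un@(_ ∷ un′) (_ ◅ c) nx with Next-functionalʳ un nx next-here
  ... | refl with Chain-loop c un′
  no-Next-first-last (s≤s (s≤s ())) _ _ _ | refl | refl

  Chain-succ : ∀ {x z ys u} → Chain E x z ys → u ∈ x ∷ ys → u ≢ z → ∃[ w ] Next (x ∷ ys) u w
  Chain-succ ε       (here refl) u≢z = ⊥-elim (u≢z refl)
  Chain-succ (_ ◅ c) (here refl) _   = _ , next-here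
  Chain-succ (_ ◅ c) (there m)   u≢z = let w , p = Chain-succ c m u≢z in w , next-there p

  Chain-suffix : ∀ {x z ys w} → Chain E x z ys → Unique (x ∷ ys) → w ∈ x ∷ ys →
    ∃[ ws ] (Chain E w z ws × (w ∷ ws) ⊆ (x ∷ ys) × Unique (w ∷ ws))
  Chain-suffix c       un       (here refl) = _ , c , id , un
  Chain-suffix (_ ◅ c) (_ ∷ un) (there m) with Chain-suffix c un m
  ... | ws , c′ , incl , un′ = ws , c′ , there ∘ incl , un′

  Chain-prefix : ∀ {x z ys w} → Chain E x z ys → Unique (x ∷ ys) → w ∈ x ∷ ys →
    ∃[ ws ] (Chain E x w ws × (x ∷ ws) ⊆ (x ∷ ys) × Unique (x ∷ ws))
  Chain-prefix c (_ ∷ _) (here refl) = [] , ε , (λ { (here refl) → here refl }) , [] ∷ []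
  Chain-prefix (e ◅ c) (x∉ ∷ un) (there m) with Chain-prefix c un m
  ... | ws , c′ , incl , un′ =
    _ ∷ ws , e ◅ c′ , (λ { (here refl) → here refl ; (there m′) → there (incl m′) }) ,
       All.tabulate (λ m′ → All.lookup x∉ (incl m′)) ∷ un′

  LastHit : (A → Bool) → A → List A → Set
  LastHit p z xs = ∃[ x₀ ] ∃[ ts ] (Chain E x₀ z ts × p x₀ ≡ true × All (λ u → p u ≡ false) ts
                                   × (x₀ ∷ ts) ⊆ xs × Unique (x₀ ∷ ts))

  last-hit-or-none : (p : A → Bool) → ∀ {x z ys} → Chain E x z ys → Unique (x ∷ ys) →
    LastHit p z (x ∷ ys) ⊎ All (λ u → p u ≡ false) (x ∷ ys)
  last-hit-or-none p {x} ε un with p x in px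
  ... | true  = inj₁ (x , [] , ε , px , [] , id , un)
  ... | false = inj₂ (px ∷ [])
  last-hit-or-none p {x} (e ◅ c) un@(_ ∷ un′) with last-hit-or-none p c un′
  ... | inj₁ (x₀ , ts , c′ , p₀ , rest , incl , u₀) = inj₁ (x₀ , ts , c′ , p₀ , rest , there ∘ incl , u₀)
  ... | inj₂ none with p x in px
  ...   | true  = inj₁ (x , _ , e ◅ c , px , none , id , un)
  ...   | false = inj₂ (px ∷ none)

  last-hit : (p : A → Bool) → ∀ {x z ys} → Chain E x z ys → Unique (x ∷ ys) → p x ≡ true → LastHit p z (x ∷ ys)
  last-hit p c un px with last-hit-or-none p c un
  ... | inj₁ hit          = hit
  ... | inj₂ (px≡false ∷ _) = ⊥-elim (true≢false px px≡false)

-- Subgraphs and walks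

⋃-vs⁺ : ∀ {n k} (F : Fin k → Sub n) i x → vs (F i) x ≡ true → vs (⋃ F) x ≡ true
⋃-vs⁺ F zero    x p = ∨-introˡ _ p
⋃-vs⁺ F (suc i) x p = ∨-introʳ (vs (F zero) x) (⋃-vs⁺ (F ∘ suc) i x p)

⋃-vs⁻ : ∀ {n k} (F : Fin k → Sub n) x → vs (⋃ F) x ≡ true → ∃[ i ] vs (F i) x ≡ true
⋃-vs⁻ {k = suc k} F x p with ∨-elim (vs (F zero) x) p
... | inj₁ q = zero , q
... | inj₂ q = let i , r = ⋃-vs⁻ (F ∘ suc) x q in suc i , r

⋃-es⁺ : ∀ {n k} (F : Fin k → Sub n) i x y → es (F i) x y ≡ true → es (⋃ F) x y ≡ true
⋃-es⁺ F zero    x y p = ∨-introˡ _ p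
⋃-es⁺ F (suc i) x y p = ∨-introʳ (es (F zero) x y) (⋃-es⁺ (F ∘ suc) i x y p)

⋃-es⁻ : ∀ {n k} (F : Fin k → Sub n) x y → es (⋃ F) x y ≡ true → ∃[ i ] es (F i) x y ≡ true
⋃-es⁻ {k = suc k} F x y p with ∨-elim (es (F zero) x y) p
... | inj₁ q = zero , q
... | inj₂ q = let i , r = ⋃-es⁻ (F ∘ suc) x y q in suc i , r

module _ {n : ℕ} where

  Edge : Sub n → Fin n → Fin n → Set
  Edge H u v = es H u v ≡ true

  Adjacent : Sub n → Fin n → Fin n → Set
  Adjacent H u v = Edge H u v ⊎ Edge H v u

  Loopless : Sub n → Set
  Loopless H = ∀ x → es H x x ≡ false

  ⊆ₛ-trans : ∀ {H K L : Sub n} → H ⊆ₛ K → K ⊆ₛ L → H ⊆ₛ L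
  ⊆ₛ-trans (vHK , eHK) (vKL , eKL) = (λ x → vKL x ∘ vHK x) , (λ x y → eKL x y ∘ eHK x y)

  _∖_ : Sub n → Fin n → Sub n
  H ∖ s = sub (λ x → vs H x ∧ x ≢ᵇ s) (λ x y → es H x y ∧ (x ≢ᵇ s ∧ y ≢ᵇ s))

  ∖-vs⁺ : ∀ {H s x} → vs H x ≡ true → x ≢ s → vs (H ∖ s) x ≡ true
  ∖-vs⁺ hx x≢s = ∧-intro hx (≢⇒≢ᵇ x≢s)

  ∖-es⁺ : ∀ {H s x y} → Edge H x y → x ≢ s → y ≢ s → Edge (H ∖ s) x y
  ∖-es⁺ e x≢s y≢s = ∧-intro e (∧-intro (≢⇒≢ᵇ x≢s) (≢⇒≢ᵇ y≢s))

  ∖-vs⁻ : ∀ {H s x} → vs (H ∖ s) x ≡ true → vs H x ≡ true × x ≢ s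
  ∖-vs⁻ {H = H} {x = x} p = ∧-elimˡ (vs H x) p , ≢ᵇ⇒≢ (∧-elimʳ (vs H x) p)

  ∖-es⁻ : ∀ {H s x y} → Edge (H ∖ s) x y → Edge H x y
  ∖-es⁻ {H = H} {x = x} {y} e = ∧-elimˡ (es H x y) e

  ∖-wf : ∀ {H s} → WF H → WF (H ∖ s)
  ∖-wf {H} {s} wf = vertex , symmetric
    where
    ends-≢ : ∀ {x y} → Edge (H ∖ s) x y → x ≢ s × y ≢ s
    ends-≢ {x} {y} e = let ≢s = ∧-elimʳ (es H x y) e in ≢ᵇ⇒≢ (∧-elimˡ (x ≢ᵇ s) ≢s) , ≢ᵇ⇒≢ (∧-elimʳ (x ≢ᵇ s) ≢s)
    vertex : ∀ x y → Edge (H ∖ s) x y → vs (H ∖ s) x ≡ true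
    vertex x y e = ∖-vs⁺ {H = H} (proj₁ wf x y (∖-es⁻ {H = H} e)) (proj₁ (ends-≢ e))
    symmetric : ∀ x y → Edge (H ∖ s) x y → Edge (H ∖ s) y x
    symmetric x y e = ∖-es⁺ {H = H} (proj₂ wf x y (∖-es⁻ {H = H} e)) (proj₂ (ends-≢ e)) (proj₁ (ends-≢ e))

  trace : List (Fin n) → Sub n
  trace xs = sub (λ v → does (v ∈? xs)) (λ u v → does (next? xs u v) ∨ does (next? xs v u))

  trace-vs⁺ : ∀ xs {v} → v ∈ xs → vs (trace xs) v ≡ true
  trace-vs⁺ xs {v} = dec-true (v ∈? xs)

  trace-vs⁻ : ∀ xs {v} → vs (trace xs) v ≡ true → v ∈ xs
  trace-vs⁻ xs {v} = dec-true⁻ (v ∈? xs)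

  trace-es⁺ : ∀ xs {u v} → Next xs u v ⊎ Next xs v u → Edge (trace xs) u v
  trace-es⁺ xs {u} {v} (inj₁ uv) = ∨-introˡ _ (dec-true (next? xs u v) uv)
  trace-es⁺ xs {u} {v} (inj₂ vu) = ∨-introʳ (does (next? xs u v)) (dec-true (next? xs v u) vu)

  trace-es⁻ : ∀ xs {u v} → Edge (trace xs) u v → Next xs u v ⊎ Next xs v u
  trace-es⁻ xs {u} {v} e with ∨-elim (does (next? xs u v)) e
  ... | inj₁ uv = inj₁ (dec-true⁻ (next? xs u v) uv)
  ... | inj₂ vu = inj₂ (dec-true⁻ (next? xs v u) vu)

  DegAtLeast-pred : ∀ {H : Sub n} {v k} → DegAtLeast H v (suc k) → DegAtLeast H v k
  DegAtLeast-pred (_ ∷ ns , refl , _ ∷ un , _ ∷ edges) = ns , refl , un , edges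

  walk-end : ∀ {H : Sub n} {x y} → Walk H x y → vs H y ≡ true
  walk-end (here p)   = p
  walk-end (step _ w) = walk-end w

  _++ʷ_ : ∀ {H : Sub n} {x y z} → Walk H x y → Walk H y z → Walk H x z
  here _   ++ʷ w′ = w′
  step e w ++ʷ w′ = step e (w ++ʷ w′)

  reverseʷ : ∀ {H : Sub n} → WF H → ∀ {x y} → Walk H x y → Walk H y x
  reverseʷ wf (here p) = here p
  reverseʷ wf {x} (step {y = y} e w) = reverseʷ wf w ++ʷ step (proj₂ wf x y e) (here (proj₁ wf x y e))

  mapʷ : ∀ {H K : Sub n} → H ⊆ₛ K → ∀ {x y} → Walk H x y → Walk K x y
  mapʷ H⊆K (here p)   = here (proj₁ H⊆K _ p)
  mapʷ H⊆K (step e w) = step (proj₂ H⊆K _ _ e) (mapʷ H⊆K w)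

  walk-preserves : ∀ {H : Sub n} (Q : Fin n → Set) → (∀ {u v} → Q u → Edge H u v → Q v) →
    ∀ {x y} → Q x → Walk H x y → Q y
  walk-preserves Q step-Q qx (here _)   = qx
  walk-preserves Q step-Q qx (step e w) = walk-preserves Q step-Q (step-Q qx e) w

  walk-from-head : ∀ {H : Sub n} {x xs v} → WF H → vs H x ≡ true →
    (∀ {u w} → Next (x ∷ xs) u w → Edge H u w) → v ∈ x ∷ xs → Walk H x v
  walk-from-head wf hx edge (here refl) = here hx
  walk-from-head {x = x} {xs = y ∷ ys} wf hx edge (there m) =
    step (edge next-here) (walk-from-head wf (proj₁ wf y x (proj₂ wf x y (edge next-here))) (edge ∘ next-there) m)

  walk-within : ∀ {H : Sub n} {x xs u v} → WF H → vs H x ≡ true →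
    (∀ {u w} → Next (x ∷ xs) u w → Edge H u w) → u ∈ x ∷ xs → v ∈ x ∷ xs → Walk H u v
  walk-within wf hx edge u∈ v∈ = reverseʷ wf (walk-from-head wf hx edge u∈) ++ʷ walk-from-head wf hx edge v∈

  loop-erase : ∀ {H : Sub n} → WF H → ∀ {u v} → Walk H u v →
    ∃[ ys ] (Chain (Edge H) u v ys × Unique (u ∷ ys) × All (λ a → vs H a ≡ true) (u ∷ ys))
  loop-erase wf (here p) = [] , ε , [] ∷ [] , p ∷ []
  loop-erase wf {u} (step {y = y} e w) with loop-erase wf w
  ... | ys , c , un , inH with u ∈? (y ∷ ys)
  ...   | yes u∈ with Chain-suffix c un u∈
  ...     | ws , c′ , incl , un′ = ws , c′ , un′ , All.tabulate (All.lookup inH ∘ incl)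
  loop-erase wf {u} (step {y = y} e w) | ys , c , un , inH | no u∉ =
    y ∷ ys , e ◅ c , ¬Any⇒All¬ (y ∷ ys) u∉ ∷ un , proj₁ wf u y e ∷ inH

  component-ends : ∀ {H C : Sub n} {X} → IsComponentAvoiding H X C → ∀ {x y} → Edge C x y →
    vs C x ≡ true × vs C y ≡ true
  component-ends {H} {C} (_ , _ , es-eq , _) {x} {y} e =
    let ends = ∧-elimʳ (es H x y) (subst (_≡ true) (es-eq x y) e)
    in ∧-elimˡ (vs C x) ends , ∧-elimʳ (vs C x) ends

  component-spread : ∀ {H C : Sub n} {X} → IsComponentAvoiding H X C → (Q : Fin n → Set) →
    (∀ {u v} → vs C u ≡ true → Q u → Edge C u v → Q v) →
    ∀ {x} → vs C x ≡ true → Q x → ∀ v → vs C v ≡ true → Q v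
  component-spread comp@(_ , _ , _ , _ , connected , _) Q extend {x} cx qx v cv =
    walk-preserves Q (λ qu e → extend (proj₁ (component-ends comp e)) qu e) qx (connected x v cx cv)

-- Cycles, degrees and leaves

module _ {n : ℕ} where

  chain-cycle : ∀ {H : Sub n} {u w v ws} → Chain (Edge H) u w ws → Unique (u ∷ ws) → v ∉ u ∷ ws →
    Edge H v u → Edge H w v → u ≢ w → HasCycle H
  chain-cycle ε         _  _  _   _   u≢w = ⊥-elim (u≢w refl)
  chain-cycle c@(_ ◅ _) un v∉ evu ewv _   =
    _ , _ , s≤s (s≤s (s≤s z≤n)) , ¬Any⇒All¬ _ v∉ ∷ un , evu ∷ Chain⇒Linked c , _ , Chain-last c , ewv

  cycle-through : ∀ {H : Sub n} {s y z} → WF H → Edge H s y → Edge H s z → y ≢ z →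
    Walk (H ∖ s) y z → HasCycle H
  cycle-through {H} {s} {y} {z} wf esy esz y≢z w with loop-erase (∖-wf wf) w
  ... | ys , c , un , avoid =
    chain-cycle {H = H} (Chain-map (∖-es⁻ {H = H}) c) un (λ s∈ → proj₂ (∖-vs⁻ {H = H} (All.lookup avoid s∈)) refl) esy (proj₂ wf s z esz) y≢z

  cycle-neighbours : ∀ {H : Sub n} {x y xs m} → 3 ≤ length (x ∷ xs) → Unique (x ∷ xs) →
    Chain (Edge H) x y xs → Edge H y x → m ∈ x ∷ xs →
    ∃[ p ] ∃[ r ] (p ≢ r × p ∈ x ∷ xs × r ∈ x ∷ xs × Adjacent H m p × Adjacent H m r)
  cycle-neighbours {H = H} {x} {y} {xs} {m} len un c eyx m∈ with m ≟ x | m ≟ y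
  ... | yes refl | yes refl with Chain-loop c un
  cycle-neighbours (s≤s ()) _ _ _ _ | yes refl | yes refl | refl
  cycle-neighbours {H = H} {x} {y} {xs} {m} len un c eyx m∈ | yes refl | no m≢y =
    let r , mr = Chain-succ c m∈ m≢y
    in y , r , (λ y≡r → no-Next-first-last len un c (subst (Next _ _) (≡.sym y≡r) mr)) , Chain-end c , Next-∈ʳ mr ,
       inj₂ eyx , inj₁ (Linked⇒Next (Chain⇒Linked c) mr)
  cycle-neighbours {H = H} {x} {y} {xs} {m} len un c eyx m∈ | no m≢x | yes refl =
    let p , pm = ∈-tail⇒Next (∈-tail m∈ m≢x)
    in p , x , (λ p≡x → no-Next-first-last len un c (subst (λ q → Next (x ∷ xs) q m) p≡x pm)) , Next-∈ˡ pm , here refl ,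
       inj₂ (Linked⇒Next (Chain⇒Linked c) pm) , inj₁ eyx
  cycle-neighbours {H = H} {x} {y} {xs} {m} len un c eyx m∈ | no m≢x | no m≢y =
    let p , pm = ∈-tail⇒Next (∈-tail m∈ m≢x)
        r , mr = Chain-succ c m∈ m≢y
    in p , r , Next-pred≢succ un pm mr , Next-∈ˡ pm , Next-∈ʳ mr ,
       inj₂ (Linked⇒Next (Chain⇒Linked c) pm) , inj₁ (Linked⇒Next (Chain⇒Linked c) mr)

  acyclic-by-depth : ∀ {H : Sub n} (depth : Fin n → ℕ) (Parent : Fin n → Fin n → Set) →
    (∀ {u v} → Edge H u v → Parent u v ⊎ Parent v u) →
    (∀ {u v} → Parent u v → depth u ≡ suc (depth v)) →
    (∀ {u v w} → Parent u v → Parent u w → v ≡ w) →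
    ¬ HasCycle H
  acyclic-by-depth {H} depth Parent orient descends parent-unique (x , xs , len , un , lnk , y , lst , eyx) =
    let p , r , p≢r , p∈ , r∈ , mp , mr = cycle-neighbours {H = H} len un (Linked⇒Chain lnk lst) eyx m∈
    in p≢r (parent-unique (towards-parent p∈ mp) (towards-parent r∈ mr))
    where
    m : Fin n
    m = argmax depth x xs
    m∈ : m ∈ x ∷ xs
    m∈ = argmax-all depth {P = _∈ x ∷ xs} (here refl) (All.tabulate there)
    maximal : ∀ {p} → p ∈ x ∷ xs → depth p ≤ depth m
    maximal (here refl) = f[⊥]≤f[argmax] {f = depth} x xs
    maximal (there p∈)  = All.lookup (f[xs]≤f[argmax] {f = depth} x xs) p∈
    towards-parent : ∀ {p} → p ∈ x ∷ xs → Adjacent H m p → Parent m p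
    towards-parent {p} p∈ adj with [ orient , swap ∘ orient ]′ adj
    ... | inj₁ m→p = m→p
    ... | inj₂ p→m = ⊥-elim (<-irrefl refl (subst (_≤ depth m) (descends p→m) (maximal p∈)))

  ¬DegAtLeast-by-classes : ∀ {H : Sub n} {v k} (Class : Fin k → Fin n → Set) →
    (∀ c {u w} → Class c u → Class c w → u ≡ w) →
    (∀ {u} → Edge H v u → ∃[ c ] Class c u) →
    ¬ DegAtLeast H v (suc k)
  ¬DegAtLeast-by-classes {k = k} Class one-per-class classify (ns , len , un , edges) =
    <-irrefl refl (subst (_≤ k) len (injective⇒≤ class-injective))
    where
    class : Fin (length ns) → Fin k
    class t = proj₁ (classify (All.lookup edges (∈-lookup t)))
    in-class : ∀ t → Class (class t) (lookup ns t)
    in-class t = proj₂ (classify (All.lookup edges (∈-lookup t)))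
    class-injective : Injective _≡_ _≡_ class
    class-injective {t} {t′} eq =
      lookup-injective un (one-per-class (class t′) (subst (λ c → Class c _) eq (in-class t)) (in-class t′))

  leaf-reachable : ∀ {H : Sub n} → IsTree H → Loopless H → ∀ {s y} → Edge H s y →
    ¬ ¬ (∃[ ℓ ] (Leaf H ℓ × Walk (H ∖ s) y ℓ))
  leaf-reachable {H} (wf , _ , _ , acyclic) loopless {s} {y} esy no-leaf =
    grow n (eys ◅ ε) (((λ { refl → true≢false esy (loopless s) }) ∷ []) ∷ [] ∷ [])
         (here (∖-vs⁺ {H = H} (proj₁ wf y s eys) (λ { refl → true≢false esy (loopless s) }))) (s≤s (n≤1+n n))
    where
    eys : Edge H y s
    eys = proj₂ wf s y esy
    -- The chain v ⋯ s grows backwards from y: a second neighbour of v either closes a cycle or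
    -- extends the chain, and a chain of distinct vertices has at most n of them.
    grow : ∀ (k : ℕ) {v L} → Chain (Edge H) v s L → Unique (v ∷ L) → Walk (H ∖ s) y v →
      suc n ≤ length (v ∷ L) + k → ⊥
    grow zero _ un _ bound =
      <-irrefl refl (≤-trans bound (subst (_≤ n) (≡.sym (+-identityʳ _)) (unique⇒length≤ un)))
    grow (suc k) ε _ w _ = proj₂ (∖-vs⁻ {H = H} (walk-end w)) refl
    grow (suc k) {v} {u ∷ L} (evu ◅ c) un w bound =
      no-leaf (v , (proj₁ (∖-vs⁻ {H = H} (walk-end w)) , (u ∷ [] , refl , [] ∷ [] , evu ∷ []) , no-second-neighbour) , w)
      where
      continue : ∀ w′ → w′ ≢ u → Edge H v w′ → ⊥
      continue w′ w′≢u evw′ with w′ ∈? (v ∷ u ∷ L)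
      ... | yes (here refl) = true≢false evw′ (loopless v)
      ... | yes (there w′∈) with Chain-prefix c (AllPairs.tail un) w′∈
      ...   | ws , c′ , incl , un′ =
        acyclic (chain-cycle {H = H} c′ un′ (Unique[x∷xs]⇒x∉xs un ∘ incl) evu (proj₂ wf v w′ evw′) (w′≢u ∘ ≡.sym))
      continue w′ w′≢u evw′ | no w′∉ =
        grow k (ew′v ◅ (evu ◅ c)) (¬Any⇒All¬ _ w′∉ ∷ un)
          (w ++ʷ step (∖-es⁺ {H = H} evw′ v≢s w′≢s) (here (∖-vs⁺ {H = H} (proj₁ wf w′ v ew′v) w′≢s)))
          (subst (suc n ≤_) (+-suc _ k) bound)
        where
        ew′v : Edge H w′ v
        ew′v = proj₂ wf v w′ evw′
        v≢s : v ≢ s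
        v≢s = proj₂ (∖-vs⁻ {H = H} (walk-end w))
        w′≢s : w′ ≢ s
        w′≢s refl = w′∉ (there (Chain-end c))
      no-second-neighbour : ¬ DegAtLeast H v 2
      no-second-neighbour (n₁ ∷ n₂ ∷ [] , refl , ((n₁≢n₂ ∷ []) ∷ _) , (e₁ ∷ e₂ ∷ [])) with n₁ ≟ u
      ... | yes refl = continue n₂ (λ n₂≡u → n₁≢n₂ (≡.sym n₂≡u)) e₂
      ... | no n₁≢u  = continue n₁ n₁≢u e₁

  ¬Leaf⇒two-neighbours : ∀ {H : Sub n} {s y} → vs H s ≡ true → Edge H s y → ¬ Leaf H s →
    ¬ ¬ (∃[ y ] ∃[ z ] (y ≢ z × Edge H s y × Edge H s z))
  ¬Leaf⇒two-neighbours {y = y} hs esy ¬leaf no-two =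
    ¬leaf (hs , (y ∷ [] , refl , [] ∷ [] , esy ∷ []) ,
           λ { (n₁ ∷ n₂ ∷ [] , refl , ((n₁≢n₂ ∷ []) ∷ _) , (e₁ ∷ e₂ ∷ [])) → no-two (n₁ , n₂ , n₁≢n₂ , e₁ , e₂) })

-- Orchards

module OrchardMyriapods {G : Graph} {a b : ℕ} (R : Orchard G a b) where
  open Orchard R

  private
    V : Set
    V = Fin (n G)

  T-wf : ∀ j → WF (T j)
  T-wf j = proj₁ (T-tree j)

  T-connected : ∀ j → Connected (T j)
  T-connected j = proj₁ (proj₂ (proj₂ (T-tree j)))

  T-acyclic : ∀ j → ¬ HasCycle (T j)
  T-acyclic j = proj₂ (proj₂ (proj₂ (T-tree j)))

  T-loopless : ∀ j → Loopless (T j)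
  T-loopless j x = ¬true⇒false (λ e → true≢false (proj₂ (proj₂ (T-sub j)) x x e) (irrefl G x))

  T-unique : ∀ {j j′ x} → vs (T j) x ≡ true → vs (T j′) x ≡ true → j ≡ j′
  T-unique {j} {j′} {x} tx tx′ with j ≟ j′
  ... | yes j≡j′ = j≡j′
  ... | no  j≢j′ = ⊥-elim (T-disj j j′ j≢j′ x tx tx′)

  P-unique : ∀ {i i′ x} → vs (P i) x ≡ true → vs (P i′) x ≡ true → i ≡ i′
  P-unique {i} {i′} {x} px px′ with i ≟ i′
  ... | yes i≡i′ = i≡i′
  ... | no  i≢i′ = ⊥-elim (P-disj i i′ i≢i′ x px px′)

  spine : Fin a → List V
  spine i = proj₁ (P-path i) ∷ proj₁ (proj₂ (P-path i))

  spine-unique : ∀ i → Unique (spine i)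
  spine-unique i = proj₁ (proj₂ (proj₂ (P-path i)))

  P-vs⇒∈spine : ∀ i {v} → vs (P i) v ≡ true → v ∈ spine i
  P-vs⇒∈spine i {v} = Equivalence.to (proj₁ (proj₂ (proj₂ (proj₂ (proj₂ (P-path i))))) v)

  ∈spine⇒P-vs : ∀ i {v} → v ∈ spine i → vs (P i) v ≡ true
  ∈spine⇒P-vs i {v} = Equivalence.from (proj₁ (proj₂ (proj₂ (proj₂ (proj₂ (P-path i))))) v)

  P-es⇒Next : ∀ i {u v} → Edge (P i) u v → Next (spine i) u v ⊎ Next (spine i) v u
  P-es⇒Next i {u} {v} e =
    Sum.map Consec⇒Next Consec⇒Next (Equivalence.to (proj₂ (proj₂ (proj₂ (proj₂ (proj₂ (P-path i))))) u v) e)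

  Next⇒P-es : ∀ i {u v} → Next (spine i) u v ⊎ Next (spine i) v u → Edge (P i) u v
  Next⇒P-es i {u} {v} nx = Equivalence.from (proj₂ (proj₂ (proj₂ (proj₂ (proj₂ (P-path i))))) u v)
    (Sum.map Next⇒Consec Next⇒Consec nx)

  P-wf : ∀ i → WF (P i)
  P-wf i = (λ x y e → ∈spine⇒P-vs i ([ Next-∈ˡ , Next-∈ʳ ]′ (P-es⇒Next i e))) ,
           (λ x y e → Next⇒P-es i (swap (P-es⇒Next i e)))

  Pall-vs⁺ : ∀ i {x} → vs (P i) x ≡ true → vs (Pall R) x ≡ true
  Pall-vs⁺ i {x} = ⋃-vs⁺ P i x

  Pall-es⁻ : ∀ i {u v} → Edge (Pall R) u v → vs (P i) u ≡ true → Edge (P i) u v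
  Pall-es⁻ i {u} {v} e pu with ⋃-es⁻ P u v e
  ... | i′ , e′ with P-unique (proj₁ (P-wf i′) u v e′) pu
  ... | refl = e′

  Tall-es⁻ : ∀ j {u v} → Edge (Tall R) u v → vs (T j) u ≡ true → Edge (T j) u v
  Tall-es⁻ j {u} {v} e tu with ⋃-es⁻ T u v e
  ... | j′ , e′ with T-unique (proj₁ (T-wf j′) u v e′) tu
  ... | refl = e′

  ≢-off-P : ∀ i {x s} → vs (P i) x ≡ true → vs (Pall R) s ≡ false → x ≢ s
  ≢-off-P i px sP refl = true≢false (Pall-vs⁺ i px) sP

  PT-point : ∀ i j → ∃[ x ] (vs (P i) x ≡ true × vs (T j) x ≡ true)
  PT-point i j = let x , pt = PT-nonempty i j in x , ∧-elimˡ (vs (P i) x) pt , ∧-elimʳ (vs (P i) x) pt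

  PT-walk-avoiding : ∀ i j {s x y} → vs (Pall R) s ≡ false →
    vs (P i) x ≡ true → vs (T j) x ≡ true → vs (P i) y ≡ true → vs (T j) y ≡ true → Walk (T j ∖ s) x y
  PT-walk-avoiding i j {s} {x} {y} sP px tx py ty =
    mapʷ (vertex , edge) (PT-connected i j x y (∧-intro px tx) (∧-intro py ty))
    where
    off : ∀ {u} → vs (P i) u ≡ true → u ≢ s
    off pu = ≢-off-P i pu sP
    vertex : ∀ u → vs (P i ∩ₛ T j) u ≡ true → vs (T j ∖ s) u ≡ true
    vertex u pt = ∖-vs⁺ {H = T j} (∧-elimʳ (vs (P i) u) pt) (off (∧-elimˡ (vs (P i) u) pt))
    edge : ∀ u v → Edge (P i ∩ₛ T j) u v → Edge (T j ∖ s) u v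
    edge u v e = ∖-es⁺ {H = T j} (∧-elimʳ (es (P i) u v) e) (off (proj₁ (P-wf i) u v eᴾ)) (off (proj₁ (P-wf i) v u (proj₂ (P-wf i) u v eᴾ)))
      where
      eᴾ : Edge (P i) u v
      eᴾ = ∧-elimˡ (es (P i) u v) e

  off-P-reaches-P : ∀ j {s y} → vs (Pall R) s ≡ false → Edge (T j) s y →
    ¬ ¬ (∃[ i ] ∃[ p ] (vs (P i) p ≡ true × vs (T j) p ≡ true × Walk (T j ∖ s) y p))
  off-P-reaches-P j sP esy found-none =
    leaf-reachable (T-tree j) (T-loopless j) esy λ (ℓ , leaf , w) →
      let i , pℓ = leaves j ℓ leaf in found-none (i , ℓ , pℓ , proj₁ leaf , w)

  off-P-two-neighbours : ∀ j {s} → vs (T j) s ≡ true → vs (Pall R) s ≡ false →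
    ¬ ¬ (∃[ y ] ∃[ z ] (y ≢ z × Edge (T j) s y × Edge (T j) s z))
  off-P-two-neighbours j {s} ts sP with PT-point (fromℕ< a-pos) j
  ... | p , pp , tp with T-connected j s p ts tp
  ... | here _   = ⊥-elim (≢-off-P _ pp sP refl)
  ... | step e _ = ¬Leaf⇒two-neighbours {H = T j} ts e λ leaf → let i , ps = leaves j s leaf in true≢false (Pall-vs⁺ i ps) sP

  record Leg (j : Fin b) (i : Fin a) : Set where
    field
      root     : V
      tail     : List V
      unique   : Unique (root ∷ tail)
      linked   : Linked (Edge (T j)) (root ∷ tail)
      in-T     : All (λ u → vs (T j) u ≡ true) (root ∷ tail)
      root-P   : vs (P i) root ≡ true
      tail-¬P  : All (λ u → vs (P i) u ≡ false) tail
      -- the leg ends on a horizontal path, so a vertex on no horizontal path is not its end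
      extends  : ∀ {u} → u ∈ tail → vs (Pall R) u ≡ false → ∃[ w ] Next (root ∷ tail) u w

    vertices : List V
    vertices = root ∷ tail

  Reaches : ∀ {j i} → Leg j i → Fin a → Set
  Reaches l i′ = ∃[ x ] (x ∈ Leg.vertices l × vs (P i′) x ≡ true)

  leg-between : ∀ j i i′ → Σ (Leg j i) (λ l → Reaches l i′)
  leg-between j i i′ with PT-point i j | PT-point i′ j
  ... | p , pp , tp | q , pq , tq with loop-erase (T-wf j) (T-connected j p q tp tq)
  ... | ys , c , un , inT with last-hit (vs (P i)) c un pp
  ... | x₀ , ts , c′ , px₀ , ts-¬P , incl , un′ = l , q , Chain-end c′ , pq
    where
    l : Leg j i
    l = record
      { root = x₀ ; tail = ts ; unique = un′ ; linked = Chain⇒Linked c′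
      ; in-T = All.tabulate (All.lookup inT ∘ incl) ; root-P = px₀ ; tail-¬P = ts-¬P
      ; extends = λ u∈ uP → Chain-succ c′ (there u∈) (λ { refl → true≢false (Pall-vs⁺ i′ pq) uP })
      }

  leg : ∀ j i i′ → Leg j i
  leg j i i′ = proj₁ (leg-between j i i′)

  leg-reaches : ∀ j i i′ → Reaches (leg j i i′) i′
  leg-reaches j i i′ = proj₂ (leg-between j i i′)

  walk-along-leg : ∀ {j i} (l : Leg j i) {s u v} → s ∉ Leg.vertices l →
    u ∈ Leg.vertices l → v ∈ Leg.vertices l → Walk (T j ∖ s) u v
  walk-along-leg {j} l s∉ =
    walk-within (∖-wf (T-wf j)) (∖-vs⁺ {H = T j} (All.lookup (Leg.in-T l) (here refl)) (off (here refl)))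
      (λ nx → ∖-es⁺ {H = T j} (Linked⇒Next (Leg.linked l) nx) (off (Next-∈ˡ nx)) (off (Next-∈ʳ nx)))
    where
    off : ∀ {u} → u ∈ Leg.vertices l → u ≢ _
    off u∈ refl = s∉ u∈

  PT-joined-avoiding : ∀ j i₁ i₂ {s p₁ p₂} → vs (Pall R) s ≡ false → s ∉ Leg.tail (leg j i₁ i₂) →
    vs (P i₁) p₁ ≡ true → vs (T j) p₁ ≡ true → vs (P i₂) p₂ ≡ true → vs (T j) p₂ ≡ true →
    Walk (T j ∖ s) p₁ p₂
  PT-joined-avoiding j i₁ i₂ sP s∉tail pp₁ tp₁ pp₂ tp₂ with leg-reaches j i₁ i₂
  ... | x , x∈ , px =
    PT-walk-avoiding i₁ j sP pp₁ tp₁ (Leg.root-P l) (All.lookup (Leg.in-T l) (here refl))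
    ++ʷ (walk-along-leg l s∉ (here refl) x∈
    ++ʷ PT-walk-avoiding i₂ j sP px (All.lookup (Leg.in-T l) x∈) pp₂ tp₂)
    where
    l : Leg j i₁
    l = leg j i₁ i₂
    s∉ : _ ∉ Leg.vertices l
    s∉ (here refl) = ≢-off-P i₁ (Leg.root-P l) sP refl
    s∉ (there s∈)  = s∉tail s∈

  off-P-on-leg : ∀ j {s} → vs (T j) s ≡ true → vs (Pall R) s ≡ false →
    ∃[ i ] ∃[ i′ ] s ∈ Leg.tail (leg j i i′)
  off-P-on-leg j {s} ts sP with any? (λ i → any? (λ i′ → s ∈? Leg.tail (leg j i i′)))
  ... | yes on-leg = on-leg
  ... | no  off-legs =
    ⊥-elim (off-P-two-neighbours j ts sP λ (y , z , y≢z , esy , esz) →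
    off-P-reaches-P j sP esy λ (i₁ , p₁ , pp₁ , tp₁ , w₁) →
    off-P-reaches-P j sP esz λ (i₂ , p₂ , pp₂ , tp₂ , w₂) →
    T-acyclic j (cycle-through (T-wf j) esy esz y≢z
      (w₁ ++ʷ (PT-joined-avoiding j i₁ i₂ sP (λ s∈ → off-legs (i₁ , i₂ , s∈)) pp₁ tp₁ pp₂ tp₂
       ++ʷ reverseʷ (∖-wf (T-wf j)) w₂))))

  leg-vertex-neighbours : ∀ {j i} (l : Leg j i) {u v} → u ∈ Leg.tail l → vs (Pall R) u ≡ false → ¬ InW R u →
    Edge (T j) u v → Next (Leg.vertices l) u v ⊎ Next (Leg.vertices l) v u
  leg-vertex-neighbours {j} l {u} {v} u∈ uP u∉W euv with ∈-tail⇒Next u∈ | Leg.extends l u∈ uP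
  ... | w₀ , w₀u | w₁ , uw₁ with v ≟ w₀ | v ≟ w₁
  ... | yes refl | _        = inj₂ w₀u
  ... | no _     | yes refl = inj₁ uw₁
  ... | no v≢w₀  | no v≢w₁  = ⊥-elim (u∉W (j , All.lookup (Leg.in-T l) (there u∈) , uP , degree-three))
    where
    degree-three : DegAtLeast (T j) u 3
    degree-three =
      w₀ ∷ w₁ ∷ v ∷ [] , refl ,
      (Next-pred≢succ (Leg.unique l) w₀u uw₁ ∷ v≢w₀ ∘ ≡.sym ∷ []) ∷ (v≢w₁ ∘ ≡.sym ∷ []) ∷ [] ∷ [] ,
      proj₂ (T-wf j) w₀ u (Linked⇒Next (Leg.linked l) w₀u) ∷ Linked⇒Next (Leg.linked l) uw₁ ∷ euv ∷ []

  module Myriapod (i : Fin a) (legs : (j : Fin b) → Leg j i) where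

    Q : Fin b → List V
    Q j = Leg.vertices (legs j)

    M : Sub (n G)
    M = P i ∪ₛ ⋃ (λ j → trace (Q j))

    M-vs⁻ : ∀ {v} → vs M v ≡ true → vs (P i) v ≡ true ⊎ ∃[ j ] v ∈ Leg.tail (legs j)
    M-vs⁻ {v} p with ∨-elim (vs (P i) v) p
    ... | inj₁ pv = inj₁ pv
    ... | inj₂ lv with ⋃-vs⁻ (λ j → trace (Q j)) v lv
    ...   | j , tv with trace-vs⁻ (Q j) tv
    ...     | here refl = inj₁ (Leg.root-P (legs j))
    ...     | there v∈  = inj₂ (j , v∈)

    M-es⁻ : ∀ {u v} → Edge M u v → Edge (P i) u v ⊎ ∃[ j ] (Next (Q j) u v ⊎ Next (Q j) v u)
    M-es⁻ {u} {v} e with ∨-elim (es (P i) u v) e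
    ... | inj₁ pe = inj₁ pe
    ... | inj₂ le = let j , te = ⋃-es⁻ (λ j → trace (Q j)) u v le in inj₂ (j , trace-es⁻ (Q j) te)

    spine⊆M : P i ⊆ₛ M
    spine⊆M = (λ x → ∨-introˡ _) , (λ x y → ∨-introˡ _)

    leg⊆M : ∀ j → trace (Q j) ⊆ₛ M
    leg⊆M j = (λ x p → ∨-introʳ (vs (P i) x) (⋃-vs⁺ (λ j → trace (Q j)) j x p)) ,
              (λ x y e → ∨-introʳ (es (P i) x y) (⋃-es⁺ (λ j → trace (Q j)) j x y e))

    Q-in-T : ∀ j {u} → u ∈ Q j → vs (T j) u ≡ true
    Q-in-T j = All.lookup (Leg.in-T (legs j))

    Q-edge : ∀ j {u v} → Next (Q j) u v ⊎ Next (Q j) v u → Edge (T j) u v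
    Q-edge j (inj₁ uv) = Linked⇒Next (Leg.linked (legs j)) uv
    Q-edge j (inj₂ vu) = proj₂ (T-wf j) _ _ (Linked⇒Next (Leg.linked (legs j)) vu)

    Q-same : ∀ {j j′ u} → u ∈ Q j → u ∈ Q j′ → j ≡ j′
    Q-same {j} {j′} u∈ u∈′ = T-unique (Q-in-T j u∈) (Q-in-T j′ u∈′)

    tail-¬spine : ∀ j {u} → u ∈ Leg.tail (legs j) → vs (P i) u ≡ true → ⊥
    tail-¬spine j u∈ pu = true≢false pu (All.lookup (Leg.tail-¬P (legs j)) u∈)

    M-wf : WF M
    M-wf = vertex , symmetric
      where
      vertex : ∀ u v → Edge M u v → vs M u ≡ true
      vertex u v e with M-es⁻ e
      ... | inj₁ pe       = proj₁ spine⊆M u (proj₁ (P-wf i) u v pe)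
      ... | inj₂ (j , nx) = proj₁ (leg⊆M j) u (trace-vs⁺ (Q j) ([ Next-∈ˡ , Next-∈ʳ ]′ nx))
      symmetric : ∀ u v → Edge M u v → Edge M v u
      symmetric u v e with M-es⁻ e
      ... | inj₁ pe       = proj₂ spine⊆M v u (proj₂ (P-wf i) u v pe)
      ... | inj₂ (j , nx) = proj₂ (leg⊆M j) v u (trace-es⁺ (Q j) (swap nx))

    head : V
    head = proj₁ (P-path i)

    along-spine : ∀ {u v} → u ∈ spine i → v ∈ spine i → Walk M u v
    along-spine = walk-within M-wf (proj₁ spine⊆M _ (∈spine⇒P-vs i (here refl)))
                                   (λ nx → proj₂ spine⊆M _ _ (Next⇒P-es i (inj₁ nx)))

    along-leg : ∀ j {u v} → u ∈ Q j → v ∈ Q j → Walk M u v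
    along-leg j = walk-within M-wf (proj₁ (leg⊆M j) _ (trace-vs⁺ (Q j) (here refl)))
                                   (λ nx → proj₂ (leg⊆M j) _ _ (trace-es⁺ (Q j) (inj₁ nx)))

    walk-to-head : ∀ {u} → vs M u ≡ true → Walk M u head
    walk-to-head p with M-vs⁻ p
    ... | inj₁ pu       = along-spine (P-vs⇒∈spine i pu) (here refl)
    ... | inj₂ (j , u∈) = along-leg j (there u∈) (here refl)
                          ++ʷ along-spine (P-vs⇒∈spine i (Leg.root-P (legs j))) (here refl)

    M-connected : Connected M
    M-connected u v pu pv = walk-to-head pu ++ʷ reverseʷ M-wf (walk-to-head pv)

    Parent : V → V → Set
    Parent v u = Next (spine i) u v ⊎ ∃[ j ] Next (Q j) u v

    depth : V → ℕ
    depth v with v ∈? spine i | any? (λ j → v ∈? Leg.tail (legs j))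
    ... | yes _ | _           = index v (spine i)
    ... | no  _ | yes (j , _) = index (Leg.root (legs j)) (spine i) + index v (Q j)
    ... | no  _ | no  _       = 0

    depth-spine : ∀ {v} → v ∈ spine i → depth v ≡ index v (spine i)
    depth-spine {v} v∈ with v ∈? spine i | any? (λ j → v ∈? Leg.tail (legs j))
    ... | yes _ | _ = refl
    ... | no v∉ | _ = ⊥-elim (v∉ v∈)

    depth-leg : ∀ j {v} → v ∈ Q j → depth v ≡ index (Leg.root (legs j)) (spine i) + index v (Q j)
    depth-leg j {v} (here refl) = begin
      depth v                                  ≡⟨ depth-spine (P-vs⇒∈spine i (Leg.root-P (legs j))) ⟩
      index v (spine i)                        ≡⟨ ≡.sym (+-identityʳ _) ⟩
      index v (spine i) + 0                    ≡⟨ cong (index v (spine i) +_) (≡.sym (index-head v (Leg.tail (legs j)))) ⟩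
      index v (spine i) + index v (Q j)        ∎
      where open ≡.≡-Reasoning
    depth-leg j {v} (there v∈) with v ∈? spine i | any? (λ j → v ∈? Leg.tail (legs j))
    ... | yes v∈sp     | _ = ⊥-elim (tail-¬spine j v∈ (∈spine⇒P-vs i v∈sp))
    ... | no _ | yes (j′ , v∈′) with Q-same (there v∈′) (there v∈)
    ...   | refl = refl
    depth-leg j {v} (there v∈) | no _ | no  none = ⊥-elim (none (j , v∈))

    descends : ∀ {u v} → Parent u v → depth u ≡ suc (depth v)
    descends {u} {v} (inj₁ vu) = begin
      depth u                  ≡⟨ depth-spine (Next-∈ʳ vu) ⟩
      index u (spine i)        ≡⟨ Next-index (spine-unique i) vu ⟩
      suc (index v (spine i))  ≡⟨ cong suc (≡.sym (depth-spine (Next-∈ˡ vu))) ⟩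
      suc (depth v)            ∎
      where open ≡.≡-Reasoning
    descends {u} {v} (inj₂ (j , vu)) = begin
      depth u                 ≡⟨ depth-leg j (Next-∈ʳ vu) ⟩
      r + index u (Q j)       ≡⟨ cong (r +_) (Next-index (Leg.unique (legs j)) vu) ⟩
      r + suc (index v (Q j)) ≡⟨ +-suc r _ ⟩
      suc (r + index v (Q j)) ≡⟨ cong suc (≡.sym (depth-leg j (Next-∈ˡ vu))) ⟩
      suc (depth v)           ∎
      where
      open ≡.≡-Reasoning
      r : ℕ
      r = index (Leg.root (legs j)) (spine i)

    orient : ∀ {u v} → Edge M u v → Parent u v ⊎ Parent v u
    orient e with M-es⁻ e
    ... | inj₁ pe with P-es⇒Next i pe
    ...   | inj₁ uv = inj₂ (inj₁ uv)
    ...   | inj₂ vu = inj₁ (inj₁ vu)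
    orient e | inj₂ (j , inj₁ uv) = inj₂ (inj₂ (j , uv))
    orient e | inj₂ (j , inj₂ vu) = inj₁ (inj₂ (j , vu))

    parent-unique : ∀ {u v w} → Parent u v → Parent u w → v ≡ w
    parent-unique (inj₁ vu) (inj₁ wu) = Next-functionalˡ (spine-unique i) vu wu
    parent-unique (inj₁ vu) (inj₂ (j , wu)) = ⊥-elim (tail-¬spine j (Next-∈-tail wu) (∈spine⇒P-vs i (Next-∈ʳ vu)))
    parent-unique (inj₂ (j , vu)) (inj₁ wu) = ⊥-elim (tail-¬spine j (Next-∈-tail vu) (∈spine⇒P-vs i (Next-∈ʳ wu)))
    parent-unique (inj₂ (j , vu)) (inj₂ (j′ , wu)) with Q-same (Next-∈ʳ vu) (Next-∈ʳ wu)
    ... | refl = Next-functionalˡ (Leg.unique (legs j)) vu wu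

    M-tree : IsTree M
    M-tree = M-wf , (head , proj₁ spine⊆M _ (∈spine⇒P-vs i (here refl))) , M-connected ,
             acyclic-by-depth {H = M} depth Parent orient descends parent-unique

    tail-degree≤2 : ∀ j {v} → v ∈ Leg.tail (legs j) → ¬ DegAtLeast M v 3
    tail-degree≤2 j {v} v∈ = ¬DegAtLeast-by-classes {H = M} Class one-per-class classify
      where
      Class : Fin 2 → V → Set
      Class zero       u = Next (Q j) v u
      Class (suc zero) u = Next (Q j) u v
      one-per-class : ∀ c {u w} → Class c u → Class c w → u ≡ w
      one-per-class zero       = Next-functionalʳ (Leg.unique (legs j))
      one-per-class (suc zero) = Next-functionalˡ (Leg.unique (legs j))
      classify : ∀ {u} → Edge M v u → ∃[ c ] Class c u
      classify e with M-es⁻ e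
      ... | inj₁ pe = ⊥-elim (tail-¬spine j v∈ (proj₁ (P-wf i) _ _ pe))
      ... | inj₂ (j′ , inj₁ vu) with Q-same (Next-∈ˡ vu) (there v∈)
      ...   | refl = zero , vu
      classify e | inj₂ (j′ , inj₂ uv) with Q-same (Next-∈ʳ uv) (there v∈)
      ...   | refl = suc zero , uv

    spine-degree≤3 : ∀ {v} → vs (P i) v ≡ true → ¬ DegAtLeast M v 4
    spine-degree≤3 {v} pv = ¬DegAtLeast-by-classes {H = M} Class one-per-class classify
      where
      Class : Fin 3 → V → Set
      Class zero             u = Next (spine i) v u
      Class (suc zero)       u = Next (spine i) u v
      Class (suc (suc zero)) u = ∃[ j ] Next (Q j) v u
      one-per-class : ∀ c {u w} → Class c u → Class c w → u ≡ w
      one-per-class zero             = Next-functionalʳ (spine-unique i)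
      one-per-class (suc zero)       = Next-functionalˡ (spine-unique i)
      one-per-class (suc (suc zero)) (j , vu) (j′ , vw) with Q-same (Next-∈ˡ vu) (Next-∈ˡ vw)
      ... | refl = Next-functionalʳ (Leg.unique (legs j)) vu vw
      classify : ∀ {u} → Edge M v u → ∃[ c ] Class c u
      classify e with M-es⁻ e
      ... | inj₁ pe with P-es⇒Next i pe
      ...   | inj₁ vu = zero , vu
      ...   | inj₂ uv = suc zero , uv
      classify e | inj₂ (j , inj₁ vu) = suc (suc zero) , j , vu
      classify e | inj₂ (j , inj₂ uv) = ⊥-elim (tail-¬spine j (Next-∈-tail uv) pv)

    max-degree≤3 : ∀ v → ¬ DegAtLeast M v 4
    max-degree≤3 v d@(u ∷ _ , _ , _ , e ∷ _) with M-vs⁻ (proj₁ M-wf v u e)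
    ... | inj₁ pv       = spine-degree≤3 pv d
    ... | inj₂ (j , v∈) = tail-degree≤2 j v∈ (DegAtLeast-pred {H = M} d)

    degree-three⇒spine : ∀ v → vs M v ≡ true → DegAtLeast M v 3 → vs (P i) v ≡ true
    degree-three⇒spine v p d with M-vs⁻ p
    ... | inj₁ pv       = pv
    ... | inj₂ (j , v∈) = ⊥-elim (tail-degree≤2 j v∈ d)

    legs-in-trees : ∀ L → IsComponentAvoiding M (λ x → vs (P i) x ≡ true) L → ∃[ j ] L ⊆ₛ T j
    legs-in-trees L comp@(L⊆M , avoid , _ , (x , lx) , _) with M-vs⁻ (proj₁ L⊆M x lx)
    ... | inj₁ px       = ⊥-elim (avoid x lx px)
    ... | inj₂ (j , x∈) = j , in-T , λ u v e → off-spine-edge (proj₁ (component-ends comp e)) (in-T u (proj₁ (component-ends comp e))) e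
      where
      off-spine-edge : ∀ {u v} → vs L u ≡ true → vs (T j) u ≡ true → Edge L u v → Edge (T j) u v
      off-spine-edge lu tu e with M-es⁻ (proj₂ L⊆M _ _ e)
      ... | inj₁ pe        = ⊥-elim (avoid _ lu (proj₁ (P-wf i) _ _ pe))
      ... | inj₂ (j′ , nx) with T-unique (Q-in-T j′ ([ Next-∈ˡ , Next-∈ʳ ]′ nx)) tu
      ...   | refl = Q-edge j nx
      in-T : ∀ v → vs L v ≡ true → vs (T j) v ≡ true
      in-T = component-spread comp (λ u → vs (T j) u ≡ true)
               (λ {u} {v} lu tu e → proj₁ (T-wf j) v u (proj₂ (T-wf j) u v (off-spine-edge lu tu e)))
               lx (Q-in-T j (there x∈))

    M⊆R : M ⊆ₛ Rsub R
    M⊆R = vertex , edge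
      where
      vertex : ∀ v → vs M v ≡ true → vs (Rsub R) v ≡ true
      vertex v p with M-vs⁻ p
      ... | inj₁ pv       = ∨-introˡ _ (Pall-vs⁺ i pv)
      ... | inj₂ (j , v∈) = ∨-introʳ (vs (Pall R) v) (⋃-vs⁺ T j v (Q-in-T j (there v∈)))
      edge : ∀ u v → Edge M u v → Edge (Rsub R) u v
      edge u v e with M-es⁻ e
      ... | inj₁ pe       = ∨-introˡ _ (⋃-es⁺ P i u v pe)
      ... | inj₂ (j , nx) = ∨-introʳ (es (Pall R) u v) (⋃-es⁺ T j u v (Q-edge j nx))

    good : GoodMyriapod R M
    good = M⊆R , i , M-tree , max-degree≤3 , spine⊆M , degree-three⇒spine , legs-in-trees

  myriapod : Fin a → Fin a → Sub (n G)
  myriapod i i′ = Myriapod.M i (λ j → leg j i i′)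

  myriapod-good : ∀ i i′ → GoodMyriapod R (myriapod i i′)
  myriapod-good i i′ = Myriapod.good i (λ j → leg j i i′)

  horizontal-section⊆spine : ∀ {S} → HorizontalSection R S → ∃[ i ] S ⊆ₛ P i
  horizontal-section⊆spine (inj₁ (i , j , vs-eq , es-eq)) =
    i , (λ x p → ∧-elimˡ (vs (P i) x) (trans (≡.sym (vs-eq x)) p)) ,
        (λ x y e → ∧-elimˡ (es (P i) x y) (trans (≡.sym (es-eq x y)) e))
  horizontal-section⊆spine {S} (inj₂ comp@(S⊆Pall , _ , _ , (x , sx) , _)) with ⋃-vs⁻ P x (proj₁ S⊆Pall x sx)
  ... | i , px = i , on-spine , λ u v e → spine-edge (on-spine u (proj₁ (component-ends comp e))) e
    where
    spine-edge : ∀ {u v} → vs (P i) u ≡ true → Edge S u v → Edge (P i) u v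
    spine-edge pu e = Pall-es⁻ i (proj₂ S⊆Pall _ _ e) pu
    on-spine : ∀ v → vs S v ≡ true → vs (P i) v ≡ true
    on-spine = component-spread comp (λ u → vs (P i) u ≡ true)
                 (λ {u} {v} _ pu e → proj₁ (P-wf i) v u (proj₂ (P-wf i) u v (spine-edge pu e))) sx px

  vertical-section⊆leg : ∀ {S} → VerticalSection R S → ∃[ j ] ∃[ i ] ∃[ i′ ] S ⊆ₛ trace (Leg.vertices (leg j i i′))
  vertical-section⊆leg (inj₁ (w , (j , tw , wP , _) , vs-eq , es-eq)) =
    let i , i′ , w∈ = off-P-on-leg j tw wP
    in j , i , i′ ,
       (λ x p → trace-vs⁺ (Leg.vertices (leg j i i′)) (subst (_∈ _) (≡.sym (dec-true⁻ (x ≟ w) (trans (≡.sym (vs-eq x)) p))) (there w∈))) ,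
       (λ x y e → ⊥-elim (true≢false (trans (≡.sym (es-eq x y)) e) refl))
  vertical-section⊆leg {S} (inj₂ comp@(S⊆Tall , avoid , _ , (x , sx) , _)) with ⋃-vs⁻ T x (proj₁ S⊆Tall x sx)
  ... | j , tx with off-P-on-leg j tx (¬true⇒false (avoid x sx ∘ inj₁))
  ... | i , i′ , x∈ = j , i , i′ , (λ v sv → trace-vs⁺ (Leg.vertices l) (there (on-leg v sv))) , λ u v e → trace-es⁺ (Leg.vertices l) (leg-step e)
    where
    l : Leg j i
    l = leg j i i′
    off-Pall : ∀ {u} → vs S u ≡ true → vs (Pall R) u ≡ false
    off-Pall su = ¬true⇒false (avoid _ su ∘ inj₁)
    along-leg : ∀ {u v} → vs S u ≡ true → u ∈ Leg.tail l → Edge S u v →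
      Next (Leg.vertices l) u v ⊎ Next (Leg.vertices l) v u
    along-leg su u∈ e = leg-vertex-neighbours l u∈ (off-Pall su) (avoid _ su ∘ inj₂)
                          (Tall-es⁻ j (proj₂ S⊆Tall _ _ e) (All.lookup (Leg.in-T l) (there u∈)))
    in-tail : ∀ {v} → vs S v ≡ true → v ∈ Leg.vertices l → v ∈ Leg.tail l
    in-tail sv (here refl) = ⊥-elim (avoid _ sv (inj₁ (Pall-vs⁺ i (Leg.root-P l))))
    in-tail sv (there v∈)  = v∈
    on-leg : ∀ v → vs S v ≡ true → v ∈ Leg.tail l
    on-leg = component-spread comp (_∈ Leg.tail l)
               (λ su u∈ e → in-tail (proj₂ (component-ends comp e)) ([ Next-∈ʳ , Next-∈ˡ ]′ (along-leg su u∈ e)))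
               sx x∈
    leg-step : ∀ {u v} → Edge S u v → Next (Leg.vertices l) u v ⊎ Next (Leg.vertices l) v u
    leg-step e = let su = proj₁ (component-ends comp e) in along-leg su (on-leg _ su) e

  section-covered : ∀ {S} → Section R S → ∃[ i ] ∃[ i′ ] S ⊆ₛ myriapod i i′
  section-covered (inj₁ h) =
    let i , S⊆P = horizontal-section⊆spine h in i , i , ⊆ₛ-trans S⊆P (Myriapod.spine⊆M i (λ j → leg j i i))
  section-covered (inj₂ v) =
    let j , i , i′ , S⊆leg = vertical-section⊆leg v in i , i′ , ⊆ₛ-trans S⊆leg (Myriapod.leg⊆M i (λ j → leg j i i′) j)

lemma6p2 : (G : Graph) (a b : ℕ) (R : Orchard G a b) →
    ∃[ 𝒞 ] (length 𝒞 ≤ a * a × All (GoodMyriapod R) 𝒞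
           × (∀ S → Section R S → Any (λ M → S ⊆ₛ M) 𝒞))
lemma6p2 G a b R = 𝒞 , ≤-reflexive size , all-good , covered
  where
  open OrchardMyriapods R
  𝒞 : List (Sub (n G))
  𝒞 = cartesianProductWith myriapod (allFin a) (allFin a)
  size : length 𝒞 ≡ a * a
  size = trans (length-cartesianProductWith myriapod (allFin a) (allFin a))
               (cong₂ _*_ (length-allFin a) (length-allFin a))
  all-good : All (GoodMyriapod R) 𝒞
  all-good = Allₚ.cartesianProductWith⁺ (≡.setoid _) (≡.setoid _) myriapod (allFin a) (allFin a)
               (λ {i} {i′} _ _ → myriapod-good i i′)
  covered : ∀ S → Section R S → Any (λ M → S ⊆ₛ M) 𝒞
  covered S section =
    let i , i′ , S⊆M = section-covered section
    in Anyₚ.cartesianProductWith⁺ myriapod (λ { refl refl → S⊆M }) (∈-allFin i) (∈-allFin i′)
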